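{- Let $L/K$ be an arbitrary galtourable extension. A Galois tower of $L/K$ is a Galois composition tower if and only if each of its steps is a galsimple extension.
   Context: "Galois" means normal and separable, possibly infinite. A tower of $L/K$ is a finite sequence of intermediate fields $K=F_0\le\dots\le F_m=L$ with steps $F_{i+1}/F_i$; it is strict if $F_i\ne F_{i+1}$ for all $i$ (the tower with $m=0$ is strict). A Galois tower has all steps Galois; $L/K$ is galtourable if it admits one. An extension $E/F$ is galsimple if $E\ne F$ and every intermediate field $M$ with $M/F$ Galois equals $F$ or $E$. A refinement of $K=F_0\le\dots\le F_m=L$ is a tower $K=E_0\le\dots\le E_n=L$ with indices $0\le j_0<\dots<j_m\le n$ and $F_i=E_{j_i}$; it is proper if some $E_j$ ($1\le j\le n-1$) differs from all $F_i$; it is a Galois refinement if each $E_j$ ($1\le j\le n-1$) differing from all $F_i$ satisfies $E_j/E_{j-1}$ Galois. A Galois composition tower is a strict Galois tower admitting no proper Galois refinement. -}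

module Defs where

open import Level using (Level; _⊔_; Lift) renaming (suc to lsuc)
open import Algebra.Bundles using (CommutativeRing)
open import Data.Nat using (ℕ; zero; suc; _≤_; _<_)
open import Data.List using (List; []; _∷_; map; foldr)
open import Data.List.Relation.Unary.All using (All)
open import Data.Product using (Σ; ∃; _×_; _,_)
open import Data.Sum using (_⊎_)
open import Data.Unit.Polymorphic using (⊤)
open import Relation.Nullary using (¬_)

record Field (c ℓ : Level) : Set (lsuc (c ⊔ ℓ)) where
  field
    commRing : CommutativeRing c ℓ
  open CommutativeRing commRing public hiding (ring)
  field
    0≉1     : ¬ (0# ≈ 1#)
    inverse : ∀ x → ¬ (x ≈ 0#) → Σ Carrier λ y → x * y ≈ 1#

-- Everything below lives inside a fixed ambient field L.
-- An extension L/K is given by a subfield K of L; intermediate fields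
-- are subfields M of L with K ⊆ M.

module _ {c ℓ : Level} (L : Field c ℓ) where
  open Field L

  record Subfield (p : Level) : Set (c ⊔ ℓ ⊔ lsuc p) where
    field
      mem        : Carrier → Set p
      resp       : ∀ {x y} → x ≈ y → mem x → mem y
      0∈         : mem 0#
      1∈         : mem 1#
      +-closed   : ∀ {x y} → mem x → mem y → mem (x + y)
      neg-closed : ∀ {x} → mem x → mem (- x)
      *-closed   : ∀ {x y} → mem x → mem y → mem (x * y)
      inv-closed : ∀ {x y} → mem x → x * y ≈ 1# → mem y
  open Subfield public

  whole : ∀ {p} → Subfield p
  whole = record
    { mem = λ _ → ⊤ ; resp = λ _ _ → _ ; 0∈ = _ ; 1∈ = _
    ; +-closed = λ _ _ → _ ; neg-closed = λ _ → _ ; *-closed = λ _ _ → _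
    ; inv-closed = λ _ _ → _ }

  module _ {p : Level} where

    _⊆_ : Subfield p → Subfield p → Set (c ⊔ p)
    F ⊆ E = ∀ x → mem F x → mem E x

    _≐_ : Subfield p → Subfield p → Set (c ⊔ p)
    F ≐ E = (F ⊆ E) × (E ⊆ F)

    -- Polynomials: coefficient lists, lowest degree first.

    Poly : Set c
    Poly = List Carrier

    _+ₚ_ : Poly → Poly → Poly
    [] +ₚ q = q
    (a ∷ p) +ₚ [] = a ∷ p
    (a ∷ p) +ₚ (b ∷ q) = (a + b) ∷ (p +ₚ q)

    _·ₚ_ : Carrier → Poly → Poly
    a ·ₚ q = map (a *_) q

    _*ₚ_ : Poly → Poly → Poly
    [] *ₚ q = []
    (a ∷ p) *ₚ q = (a ·ₚ q) +ₚ (0# ∷ (p *ₚ q))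

    _≈ₚ_ : Poly → Poly → Set ℓ
    [] ≈ₚ [] = ⊤
    [] ≈ₚ (b ∷ q) = (b ≈ 0#) × ([] ≈ₚ q)
    (a ∷ p) ≈ₚ [] = (a ≈ 0#) × (p ≈ₚ [])
    (a ∷ p) ≈ₚ (b ∷ q) = (a ≈ b) × (p ≈ₚ q)

    eval : Poly → Carrier → Carrier
    eval f x = foldr (λ a acc → a + x * acc) 0# f

    _•_ : ℕ → Carrier → Carrier
    zero • b = 0#
    suc n • b = b + (n • b)

    deriv : Poly → Poly
    deriv [] = []
    deriv (a ∷ p) = go 1 p
      where
      go : ℕ → Poly → Poly
      go n [] = []
      go n (b ∷ q) = (n • b) ∷ go (suc n) q

    IsConst : Poly → Set ℓ
    IsConst [] = ⊤
    IsConst (a ∷ p) = p ≈ₚ []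

    Over : Subfield p → Poly → Set (c ⊔ p)
    Over F f = All (mem F) f

    Irreducible : Subfield p → Poly → Set (c ⊔ ℓ ⊔ p)
    Irreducible F f =
      Over F f × ¬ IsConst f ×
      (∀ g h → Over F g → Over F h → f ≈ₚ (g *ₚ h) → IsConst g ⊎ IsConst h)

    SeparablePoly : Subfield p → Poly → Set (c ⊔ ℓ ⊔ p)
    SeparablePoly F f =
      Σ Poly λ u → Σ Poly λ v → Over F u × Over F v ×
        (((u *ₚ f) +ₚ (v *ₚ deriv f)) ≈ₚ (1# ∷ []))

    linear : Carrier → Poly
    linear r = (- r) ∷ 1# ∷ []

    prodₚ : List Poly → Poly
    prodₚ = foldr _*ₚ_ (1# ∷ [])

    Splits : Subfield p → Poly → Set (c ⊔ ℓ ⊔ p)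
    Splits E f = Σ Carrier λ a → Σ (List Carrier) λ rs →
      mem E a × All (mem E) rs × (f ≈ₚ (a ·ₚ prodₚ (map linear rs)))

    Algebraic : Subfield p → Carrier → Set (c ⊔ ℓ ⊔ p)
    Algebraic F α = Σ Poly λ f → Over F f × ¬ (f ≈ₚ []) × (eval f α ≈ 0#)

    -- α is separable over F: its minimal polynomial (= the irreducible
    -- polynomial over F having α as a root, up to scalar) is separable
    SeparableElt : Subfield p → Carrier → Set (c ⊔ ℓ ⊔ p)
    SeparableElt F α = Σ Poly λ f →
      Irreducible F f × (eval f α ≈ 0#) × SeparablePoly F f

    Normal : Subfield p → Subfield p → Set (c ⊔ ℓ ⊔ p)
    Normal F E =
      (∀ α → mem E α → Algebraic F α) ×
      (∀ f α → Irreducible F f → mem E α → eval f α ≈ 0# → Splits E f)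

    Separable : Subfield p → Subfield p → Set (c ⊔ ℓ ⊔ p)
    Separable F E = ∀ α → mem E α → SeparableElt F α

    Galois : Subfield p → Subfield p → Set (c ⊔ ℓ ⊔ p)
    Galois F E = Normal F E × Separable F E

    -- Towers of L/K.  A tower K = F 0 ≤ ... ≤ F m = L is a length m and a
    -- family F : ℕ → Subfield (values beyond m are irrelevant).

    record Tower (K : Subfield p) : Set (c ⊔ ℓ ⊔ lsuc p) where
      constructor tower
      field
        len   : ℕ
        fld   : ℕ → Subfield p
        start : fld 0 ≐ K
        end   : fld len ≐ whole
        mono  : ∀ i → i < len → fld i ⊆ fld (suc i)
    open Tower public

    module _ {K : Subfield p} where

      Strict : Tower K → Set (c ⊔ p)
      Strict T = ∀ i → i < len T → ¬ (fld T i ≐ fld T (suc i))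

      GaloisTower : Tower K → Set (c ⊔ ℓ ⊔ p)
      GaloisTower T = ∀ i → i < len T → Galois (fld T i) (fld T (suc i))

      Refinement : (T E : Tower K) → (ℕ → ℕ) → Set (c ⊔ p)
      Refinement T E j =
        (∀ i → i < len T → j i < j (suc i)) × (j (len T) ≤ len E) ×
        (∀ i → i ≤ len T → fld T i ≐ fld E (j i))

      New : (T E : Tower K) → ℕ → Set (c ⊔ p)
      New T E k = ∀ i → i ≤ len T → ¬ (fld E k ≐ fld T i)

      Proper : (T E : Tower K) → Set (c ⊔ p)
      Proper T E = Σ ℕ λ k → 1 ≤ k × k < len E × New T E k

      GaloisRefinementCond : (T E : Tower K) → Set (c ⊔ ℓ ⊔ p)
      GaloisRefinementCond T E =
        ∀ k → suc k < len E → New T E (suc k) →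
          Galois (fld E k) (fld E (suc k))

      GaloisCompositionTower : Tower K → Set (c ⊔ ℓ ⊔ lsuc p)
      GaloisCompositionTower T =
        Strict T × GaloisTower T ×
        ¬ (Σ (Tower K) λ E → Σ (ℕ → ℕ) λ j →
             Refinement T E j × Proper T E × GaloisRefinementCond T E)

    Galtourable : Subfield p → Set (c ⊔ ℓ ⊔ lsuc p)
    Galtourable K = Σ (Tower K) GaloisTower

    GalSimple : Subfield p → Subfield p → Set (c ⊔ ℓ ⊔ lsuc p)
    GalSimple F E = ¬ (E ≐ F) ×
      (∀ M → F ⊆ M → M ⊆ E → Galois F M → (M ≐ F) ⊎ (M ≐ E))

module Submission where

-- (⇒) Strictness gives F_{i+1} ≠ F_i.  If M/F_i were Galois with M strictly
-- between F_i and F_{i+1}, inserting M after position i would give a proper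
-- Galois refinement (`insertion-refinement`), which a composition tower
-- does not admit.  Deciding whether M equals F_i or F_{i+1} is the only use
-- of excluded middle.
--
-- (⇐) Galsimple steps are proper, so the tower is strict.  A new field E_k
-- of a refinement cannot lie before the image of F₀ nor after the image of
-- Fₘ, so j(i) ≤ k < j(i+1) for some i (`segment`).  Walking from
-- E_{j(i)} = F_i up to E_k, each E_{x+1} is either old, hence equal to F_i,
-- or new, hence Galois over E_x = F_i and by galsimplicity again equal to
-- F_i (it cannot be F_{i+1}, since E_k would then be F_{i+1}).  So E_k = F_i,
-- contradicting newness (`new-not-in-segment`, a double-negation induction).

open import Defs
open import Level using (Level; _⊔_; Lift; lift; lower)
open import Function using (_∘_)
open import Data.Nat using (ℕ; zero; suc; _<_; _≤_; z≤n; s≤s; z<s; _≟_; _≤?_; _<?_)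
open import Data.Nat.Properties
open import Data.Product using (Σ; _×_; _,_; proj₁; proj₂)
open import Data.Sum using (_⊎_; inj₁; inj₂; [_,_]′)
open import Data.Empty using (⊥-elim)
open import Data.List.Relation.Unary.All as All using ()
open import Relation.Nullary using (¬_; Dec; yes; no)
open import Relation.Nullary.Decidable using (map′)
open import Relation.Unary.Properties using (⊆′-refl; ⊆′-trans; ≐′-refl; ≐′-sym)
open import Relation.Binary.PropositionalEquality
  using (_≡_; _≢_; refl; sym; cong; subst; subst₂)
open import Axiom.ExcludedMiddle using (ExcludedMiddle)

excludedMiddle-lower : ∀ {a b} → ExcludedMiddle (a ⊔ b) → ExcludedMiddle a
excludedMiddle-lower {a} {b} em = map′ lower lift (em {Lift b _})

chain : ∀ {a r} {A : Set a} (R : A → A → Set r) →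
        (∀ {x} → R x x) → (∀ {x y z} → R x y → R y z → R x z) →
        (F : ℕ → A) {n : ℕ} → (∀ i → i < n → R (F i) (F (suc i))) →
        ∀ {s t} → s ≤ t → t ≤ n → R (F s) (F t)
chain R refl′ trans′ F step {t = zero} z≤n _ = refl′
chain R refl′ trans′ F step {s} {suc t} s≤t+1 t+1≤n with m≤n⇒m<n∨m≡n s≤t+1
... | inj₁ (s≤s s≤t) =
  trans′ (chain R refl′ trans′ F step s≤t (<⇒≤ t+1≤n)) (step t t+1≤n)
... | inj₂ refl = refl′

segment : (f : ℕ → ℕ) {k : ℕ} (q : ℕ) → f 0 ≤ k → k < f q →
          Σ ℕ λ i → i < q × f i ≤ k × k < f (suc i)
segment f zero f0≤k k<f0 = ⊥-elim (<⇒≱ k<f0 f0≤k)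
segment f {k} (suc q) f0≤k k<fq+1 with k <? f q
... | yes k<fq = let (i , i<q , fi≤k , k<fi+1) = segment f q f0≤k k<fq
                 in i , m<n⇒m<1+n i<q , fi≤k , k<fi+1
... | no k≮fq = q , ≤-refl , ≮⇒≥ k≮fq , k<fq+1

-- `insertAfter i F x` is the sequence F 0, …, F i, x, F (i+1), …, and
-- `skipAfter i` the index map sending the position of F t in F to its
-- position in the new sequence.
insertAfter : ∀ {a} {A : Set a} → ℕ → (ℕ → A) → A → ℕ → A
insertAfter zero    F x zero          = F 0
insertAfter zero    F x (suc zero)    = x
insertAfter zero    F x (suc (suc k)) = F (suc k)
insertAfter (suc i) F x zero          = F 0
insertAfter (suc i) F x (suc k)       = insertAfter i (F ∘ suc) x k

skipAfter : ℕ → ℕ → ℕ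
skipAfter zero    zero    = zero
skipAfter zero    (suc t) = suc (suc t)
skipAfter (suc i) zero    = zero
skipAfter (suc i) (suc t) = suc (skipAfter i t)

skipAfter-above : ∀ {i t} → i < t → skipAfter i t ≡ suc t
skipAfter-above {zero}  {suc t} _         = refl
skipAfter-above {suc i} {suc t} (s≤s i<t) = cong suc (skipAfter-above i<t)

skipAfter-increasing : ∀ i t → skipAfter i t < skipAfter i (suc t)
skipAfter-increasing zero    zero    = s≤s z≤n
skipAfter-increasing zero    (suc t) = ≤-refl
skipAfter-increasing (suc i) zero    = s≤s z≤n
skipAfter-increasing (suc i) (suc t) = s≤s (skipAfter-increasing i t)

skipAfter-hits : ∀ {i n k} → i < n → k ≤ suc n → k ≢ suc i →
                 Σ ℕ λ t → t ≤ n × skipAfter i t ≡ k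
skipAfter-hits {zero} {n} {zero} _ _ _ = 0 , z≤n , refl
skipAfter-hits {zero} {n} {suc zero} _ _ k≢1 = ⊥-elim (k≢1 refl)
skipAfter-hits {zero} {n} {suc (suc k)} _ (s≤s k+1≤n) _ = suc k , k+1≤n , refl
skipAfter-hits {suc i} {suc n} {zero} _ _ _ = 0 , z≤n , refl
skipAfter-hits {suc i} {suc n} {suc k} (s≤s i<n) (s≤s k≤n+1) k+1≢i+2 =
  let (t , t≤n , skip≡k) = skipAfter-hits i<n k≤n+1 (k+1≢i+2 ∘ cong suc)
  in suc t , s≤s t≤n , cong suc skip≡k

module _ {a} {A : Set a} where

  insertAfter-below : ∀ i (F : ℕ → A) x k → k ≤ i → insertAfter i F x k ≡ F k
  insertAfter-below zero    F x zero    _         = refl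
  insertAfter-below (suc i) F x zero    _         = refl
  insertAfter-below (suc i) F x (suc k) (s≤s k≤i) =
    insertAfter-below i (F ∘ suc) x k k≤i

  insertAfter-at : ∀ i (F : ℕ → A) x → insertAfter i F x (suc i) ≡ x
  insertAfter-at zero    F x = refl
  insertAfter-at (suc i) F x = insertAfter-at i (F ∘ suc) x

  insertAfter-skip : ∀ i (F : ℕ → A) x t → insertAfter i F x (skipAfter i t) ≡ F t
  insertAfter-skip zero    F x zero    = refl
  insertAfter-skip zero    F x (suc t) = refl
  insertAfter-skip (suc i) F x zero    = refl
  insertAfter-skip (suc i) F x (suc t) = insertAfter-skip i (F ∘ suc) x t

  insertAfter-above : ∀ i (F : ℕ → A) x {t} → i < t →
                      insertAfter i F x (suc t) ≡ F t
  insertAfter-above i F x {t} i<t =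
    subst (λ u → insertAfter i F x u ≡ F t) (skipAfter-above i<t)
          (insertAfter-skip i F x t)

  insertAfter-steps : ∀ {r} (R : A → A → Set r) (F : ℕ → A) (x : A) {n} i → i < n →
    (∀ k → k < n → R (F k) (F (suc k))) → R (F i) x → R x (F (suc i)) →
    ∀ k → k < suc n → R (insertAfter i F x k) (insertAfter i F x (suc k))
  insertAfter-steps R F x zero _ step Fx xF zero _ = Fx
  insertAfter-steps R F x zero _ step Fx xF (suc zero) _ = xF
  insertAfter-steps R F x zero _ step Fx xF (suc (suc k)) (s≤s k+1<n) =
    step (suc k) k+1<n
  insertAfter-steps R F x {suc n} (suc i) _ step Fx xF zero _ =
    subst (R (F 0)) (sym (insertAfter-below i (F ∘ suc) x 0 z≤n)) (step 0 z<s)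
  insertAfter-steps R F x {suc n} (suc i) (s≤s i<n) step Fx xF (suc k) (s≤s k<n+1) =
    insertAfter-steps R (F ∘ suc) x i i<n (λ k k<n → step (suc k) (s≤s k<n))
                      Fx xF k k<n+1

module _ {c ℓ p : Level} (L : Field c ℓ) where

  -- inclusion and equality of subfields of L; they are inclusion and
  -- equality of membership predicates, so the lemmas ⊆′-refl, ⊆′-trans and
  -- ≐′-sym of Relation.Unary.Properties apply to them
  infix 4 _⊑_ _≅_
  _⊑_ : Subfield L p → Subfield L p → Set (c ⊔ p)
  _⊑_ = _⊆_ L

  _≅_ : Subfield L p → Subfield L p → Set (c ⊔ p)
  _≅_ = _≐_ L

  ≡⇒≅ : {F E : Subfield L p} → F ≡ E → F ≅ E
  ≡⇒≅ refl = ≐′-refl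

  -- Galois-ness of E/F depends on F only as a set: every ingredient of the
  -- definition is monotone or invariant in the base field
  -- (the subfields are passed explicitly: Agda cannot recover a subfield
  -- from its membership predicate)
  Over-mono : {F F′ : Subfield L p} {f : Poly L {p}} →
              F ⊑ F′ → Over L F f → Over L F′ f
  Over-mono F⊑F′ = All.map (λ {x} → F⊑F′ x)

  Irreducible-resp : {F F′ : Subfield L p} {f : Poly L {p}} →
                     F ≅ F′ → Irreducible L F f → Irreducible L F′ f
  Irreducible-resp {F} {F′} (F⊑F′ , F′⊑F) (over , nonconst , factors) =
    Over-mono {F} {F′} F⊑F′ over , nonconst ,
    λ g h g∈ h∈ f≈gh →
      factors g h (Over-mono {F′} {F} F′⊑F g∈) (Over-mono {F′} {F} F′⊑F h∈) f≈gh

  SeparablePoly-mono : {F F′ : Subfield L p} {f : Poly L {p}} →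
                       F ⊑ F′ → SeparablePoly L F f → SeparablePoly L F′ f
  SeparablePoly-mono {F} {F′} F⊑F′ (u , v , u∈ , v∈ , bezout) =
    u , v , Over-mono {F} {F′} F⊑F′ u∈ , Over-mono {F} {F′} F⊑F′ v∈ , bezout

  Algebraic-mono : {F F′ : Subfield L p} {α : Field.Carrier L} →
                   F ⊑ F′ → Algebraic L F α → Algebraic L F′ α
  Algebraic-mono {F} {F′} F⊑F′ (f , f∈ , f≠0 , root) =
    f , Over-mono {F} {F′} F⊑F′ f∈ , f≠0 , root

  SeparableElt-resp : {F F′ : Subfield L p} {α : Field.Carrier L} →
                      F ≅ F′ → SeparableElt L F α → SeparableElt L F′ α
  SeparableElt-resp {F} {F′} F≅F′ (f , irr , root , sep) =
    f , Irreducible-resp {F} {F′} F≅F′ irr , root ,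
    SeparablePoly-mono {F} {F′} (proj₁ F≅F′) sep

  Galois-respˡ : {F F′ E : Subfield L p} → F ≅ F′ → Galois L F E → Galois L F′ E
  Galois-respˡ {F} {F′} F≅F′ ((algebraic , splits) , separable) =
    ((λ α α∈E → Algebraic-mono {F} {F′} (proj₁ F≅F′) (algebraic α α∈E)) ,
     (λ f α irr α∈E root →
        splits f α (Irreducible-resp {F′} {F} (≐′-sym F≅F′) irr) α∈E root)) ,
    (λ α α∈E → SeparableElt-resp {F} {F′} F≅F′ (separable α α∈E))

  module _ {K : Subfield L p} where

    GalsimpleSteps : Tower L K → Set (c ⊔ ℓ ⊔ Level.suc p)
    GalsimpleSteps T = ∀ i → i < len T → GalSimple L (fld T i) (fld T (suc i))

    ProperGaloisRefinement : Tower L K → Set (c ⊔ ℓ ⊔ Level.suc p)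
    ProperGaloisRefinement T = Σ (Tower L K) λ E → Σ (ℕ → ℕ) λ j →
      Refinement L T E j × Proper L T E × GaloisRefinementCond L T E

    tower-⊑ : (T : Tower L K) {s t : ℕ} → s ≤ t → t ≤ len T → fld T s ⊑ fld T t
    tower-⊑ T = chain _⊑_ ⊆′-refl ⊆′-trans (fld T) (mono T)

    refinement-index-≤ : (T E : Tower L K) {j : ℕ → ℕ} → Refinement L T E j →
                         ∀ {t} → t ≤ len T → j t ≤ len E
    refinement-index-≤ T E {j} (j-increasing , jm≤n , _) t≤m =
      ≤-trans (chain _≤_ ≤-refl ≤-trans j (λ t t<m → <⇒≤ (j-increasing t t<m))
                     t≤m ≤-refl)
              jm≤n

    between-consecutive : (T : Tower L K) {i : ℕ} → i < len T → (X : Subfield L p) →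
      fld T i ⊑ X → X ⊑ fld T (suc i) → ∀ t → t ≤ len T → X ≅ fld T t →
      (X ≅ fld T i) ⊎ (X ≅ fld T (suc i))
    between-consecutive T {i} i<m X Fi⊑X X⊑Fi+1 t t≤m (X⊑Ft , Ft⊑X) with t ≤? i
    ... | yes t≤i = inj₁ (⊆′-trans X⊑Ft (tower-⊑ T t≤i (<⇒≤ i<m)) , Fi⊑X)
    ... | no t≰i = inj₂ (X⊑Fi+1 , ⊆′-trans (tower-⊑ T (≰⇒> t≰i) t≤m) Ft⊑X)

    insertion-refinement : (T : Tower L K) (i : ℕ) → i < len T → (M : Subfield L p) →
      fld T i ⊑ M → M ⊑ fld T (suc i) → Galois L (fld T i) M →
      ¬ (M ≅ fld T i) → ¬ (M ≅ fld T (suc i)) → ProperGaloisRefinement T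
    insertion-refinement T i i<m M Fi⊑M M⊑Fi+1 galois M≠Fi M≠Fi+1 =
      E , skipAfter i , refines , proper , galoisCond
      where
      F G : ℕ → Subfield L p
      F = fld T
      G = insertAfter i F M

      E : Tower L K
      E = tower (suc (len T)) G
            (subst (_≅ K) (sym (insertAfter-below i F M 0 z≤n)) (start T))
            (subst (_≅ whole L) (sym (insertAfter-above i F M i<m)) (end T))
            (insertAfter-steps _⊑_ F M i i<m (mono T) Fi⊑M M⊑Fi+1)

      refines : Refinement L T E (skipAfter i)
      refines = (λ t _ → skipAfter-increasing i t) ,
                ≤-reflexive (skipAfter-above i<m) ,
                (λ t _ → ≡⇒≅ (sym (insertAfter-skip i F M t)))

      proper : Proper L T E
      proper = suc i , s≤s z≤n , s≤s i<m , λ t t≤m M≅Ft →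
        [ M≠Fi , M≠Fi+1 ]′ (between-consecutive T i<m M Fi⊑M M⊑Fi+1 t t≤m
                              (subst (_≅ F t) (insertAfter-at i F M) M≅Ft))

      galoisCond : GaloisRefinementCond L T E
      galoisCond k k+1<n new with k ≟ i
      ... | yes refl = subst₂ (Galois L) (sym (insertAfter-below i F M i ≤-refl))
                                         (sym (insertAfter-at i F M)) galois
      ... | no k≢i =
        let (t , t≤m , skip≡k+1) = skipAfter-hits i<m (<⇒≤ k+1<n) (k≢i ∘ suc-injective)
            Gk+1≡Ft = subst (λ u → G u ≡ F t) skip≡k+1 (insertAfter-skip i F M t)
        in ⊥-elim (new t t≤m (≡⇒≅ Gk+1≡Ft))

    composition⇒galsimple : ExcludedMiddle (c ⊔ ℓ ⊔ p) → (T : Tower L K) →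
                            GaloisCompositionTower L T → GalsimpleSteps T
    composition⇒galsimple em T (strict , _ , noRefinement) i i<m =
      (λ Fi+1≅Fi → strict i i<m (≐′-sym Fi+1≅Fi)) , onlyTrivial
      where
      -- the only classical step
      decide : (P : Set (c ⊔ p)) → Dec P
      decide P = excludedMiddle-lower {c ⊔ p} {ℓ} em

      onlyTrivial : ∀ M → fld T i ⊑ M → M ⊑ fld T (suc i) → Galois L (fld T i) M →
                    (M ≅ fld T i) ⊎ (M ≅ fld T (suc i))
      onlyTrivial M Fi⊑M M⊑Fi+1 galois
        with decide (M ≅ fld T i) | decide (M ≅ fld T (suc i))
      ... | yes M≅Fi | _         = inj₁ M≅Fi
      ... | no _     | yes M≅Fi+1 = inj₂ M≅Fi+1
      ... | no M≠Fi  | no M≠Fi+1  = ⊥-elim (noRefinement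
            (insertion-refinement T i i<m M Fi⊑M M⊑Fi+1 galois M≠Fi M≠Fi+1))

    -- If all steps are galsimple, a Galois refinement has no new field in
    -- a segment j i ≤ k < j (i + 1): walking up from E_{j i} = F_i every
    -- field stays equal to F_i.
    new-not-in-segment : (T : Tower L K) → GalsimpleSteps T →
      (E : Tower L K) (j : ℕ → ℕ) → Refinement L T E j → GaloisRefinementCond L T E →
      ∀ {k} i → i < len T → j i ≤ k → k < j (suc i) → ¬ New L T E k
    new-not-in-segment T galsimple E j refines@(_ , _ , F≅Gj) galoisCond {k}
                       i i<m ji≤k k<ji+1 newk =
      stays k ji≤k ≤-refl (newk i (<⇒≤ i<m))
      where
      F G : ℕ → Subfield L p
      F = fld T
      G = fld E

      ji+1≤n : j (suc i) ≤ len E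
      ji+1≤n = refinement-index-≤ T E refines i<m

      k<n : k < len E
      k<n = <-≤-trans k<ji+1 ji+1≤n

      Gk⊑Fi+1 : G k ⊑ F (suc i)
      Gk⊑Fi+1 = ⊆′-trans (tower-⊑ E (<⇒≤ k<ji+1) ji+1≤n)
                         (proj₂ (F≅Gj (suc i) i<m))

      -- F_{i+1} ⊆ E_x with x ≤ k would make E_k = F_{i+1} old
      below-top : ∀ x → x ≤ k → ¬ (F (suc i) ⊑ G x)
      below-top x x≤k Fi+1⊑Gx =
        newk (suc i) i<m (Gk⊑Fi+1 , ⊆′-trans Fi+1⊑Gx (tower-⊑ E x≤k (<⇒≤ k<n)))

      -- one step of the walk: if E_x = F_i then E_{x+1} = F_i, because
      -- otherwise E_{x+1} is new, hence Galois over F_i, contradicting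
      -- galsimplicity of F_{i+1}/F_i
      step : ∀ x → suc x ≤ k → G x ≅ F i → ¬ ¬ (G (suc x) ≅ F i)
      step x x+1≤k Gx≅Fi Gx+1≠Fi =
        neither (proj₂ (galsimple i i<m) (G (suc x)) Fi⊑Gx+1 Gx+1⊑Fi+1 galois)
        where
        x+1<n : suc x < len E
        x+1<n = ≤-<-trans x+1≤k k<n

        Fi⊑Gx+1 : F i ⊑ G (suc x)
        Fi⊑Gx+1 = ⊆′-trans (proj₂ Gx≅Fi) (mono E x (<⇒≤ x+1<n))

        Gx+1⊑Fi+1 : G (suc x) ⊑ F (suc i)
        Gx+1⊑Fi+1 = ⊆′-trans (tower-⊑ E x+1≤k (<⇒≤ k<n)) Gk⊑Fi+1

        neither : ¬ ((G (suc x) ≅ F i) ⊎ (G (suc x) ≅ F (suc i)))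
        neither = [ Gx+1≠Fi , below-top (suc x) x+1≤k ∘ proj₂ ]′

        new : New L T E (suc x)
        new t t≤m Gx+1≅Ft =
          neither (between-consecutive T i<m (G (suc x)) Fi⊑Gx+1 Gx+1⊑Fi+1 t t≤m Gx+1≅Ft)

        galois : Galois L (F i) (G (suc x))
        galois = Galois-respˡ {G x} {F i} {G (suc x)} Gx≅Fi (galoisCond x x+1<n new)

      stays : ∀ x → j i ≤ x → x ≤ k → ¬ ¬ (G x ≅ F i)
      stays x ji≤x x≤k with m≤n⇒m<n∨m≡n ji≤x
      stays x _ _ | inj₂ refl = λ Gji≠Fi → Gji≠Fi (≐′-sym (F≅Gj i (<⇒≤ i<m)))
      stays (suc x) _ x+1≤k | inj₁ (s≤s ji≤x) =
        λ Gx+1≠Fi →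
          stays x ji≤x (<⇒≤ x+1≤k) (λ Gx≅Fi → step x x+1≤k Gx≅Fi Gx+1≠Fi)

    -- (⇐, main part) With galsimple steps there is no proper Galois
    -- refinement: a new field E_k cannot precede the image of F₀, cannot
    -- follow the image of Fₘ, and cannot lie in a segment in between.
    galsimple⇒no-refinement : (T : Tower L K) → GalsimpleSteps T → ¬ ProperGaloisRefinement T
    galsimple⇒no-refinement T galsimple
      (E , j , refines@(_ , _ , F≅Gj) , (k , _ , k<n , newk) , galoisCond)
      with k <? j 0 | k <? j (len T)
    ... | yes k<j0 | _ = newk 0 z≤n (Gk⊑F0 , F0⊑Gk)
      where
      Gk⊑F0 : fld E k ⊑ fld T 0
      Gk⊑F0 = ⊆′-trans (tower-⊑ E (<⇒≤ k<j0) (refinement-index-≤ T E refines z≤n))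
                       (proj₂ (F≅Gj 0 z≤n))
      F0⊑Gk : fld T 0 ⊑ fld E k
      F0⊑Gk = ⊆′-trans (proj₁ (start T))
                       (⊆′-trans (proj₂ (start E)) (tower-⊑ E z≤n (<⇒≤ k<n)))
    ... | no k≮j0 | yes k<jm =
      let (i , i<m , ji≤k , k<ji+1) = segment j (len T) (≮⇒≥ k≮j0) k<jm
      in new-not-in-segment T galsimple E j refines galoisCond i i<m ji≤k k<ji+1 newk
    ... | no _ | no k≮jm = newk (len T) ≤-refl (Gk⊑Fm , Fm⊑Gk)
      where
      Gk⊑Fm : fld E k ⊑ fld T (len T)
      Gk⊑Fm x _ = proj₂ (end T) x _
      Fm⊑Gk : fld T (len T) ⊑ fld E k
      Fm⊑Gk = ⊆′-trans (proj₁ (F≅Gj (len T) ≤-refl))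
                       (tower-⊑ E (≮⇒≥ k≮jm) (<⇒≤ k<n))

    galsimple⇒composition : (T : Tower L K) → GaloisTower L T → GalsimpleSteps T →
                            GaloisCompositionTower L T
    galsimple⇒composition T galoisTower galsimple =
      (λ i i<m Fi≅Fi+1 → proj₁ (galsimple i i<m) (≐′-sym Fi≅Fi+1)) ,
      galoisTower ,
      galsimple⇒no-refinement T galsimple

-- Proposition 1.3.  (Galtourability of L/K only guarantees that Galois
-- towers exist; the equivalence holds for each of them.)
proposition1p3 : {c ℓ p : Level} → ExcludedMiddle (c ⊔ ℓ ⊔ p) →
    (L : Field c ℓ) (K : Subfield L p) → Galtourable L K →
    (T : Tower L K) → GaloisTower L T →
    (GaloisCompositionTower L T →
       (∀ i → i < len T → GalSimple L (fld T i) (fld T (Data.Nat.suc i))))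
    × ((∀ i → i < len T → GalSimple L (fld T i) (fld T (Data.Nat.suc i))) →
       GaloisCompositionTower L T)
proposition1p3 em L K _ T galoisTower =
  composition⇒galsimple L em T , galsimple⇒composition L T galoisTower
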